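{- The schema $\neg\boxdot\phi\to\boxdot\neg\boxdot\phi$ is not valid on the class of Euclidean bimodal frames: there exist a bimodal model $\mathcal{M}=\langle S,R_1,R_2,V\rangle$ with $R_1$ and $R_2$ Euclidean, a point $s\in S$ and a formula $\phi\in\mathcal{L}(\boxdot)$ such that $\mathcal{M},s\nvDash\neg\boxdot\phi\to\boxdot\neg\boxdot\phi$.
   Context: Fix a nonempty set $\mathbf{P}$ of propositional variables; $\mathcal{L}(\boxdot)$ is given by $\phi::=p\mid\neg\phi\mid(\phi\land\phi)\mid\boxdot\phi$, $p\in\mathbf{P}$. A bimodal model is $\langle S,R_1,R_2,V\rangle$ with $S$ nonempty, $R_1,R_2\subseteq S\times S$, $V:\mathbf{P}\to\mathcal{P}(S)$. $\mathcal{M},s\vDash\boxdot\phi$ iff for all $t,u$ with $sR_1t$ and $sR_2u$, $(\mathcal{M},t\vDash\phi\iff\mathcal{M},u\vDash\phi)$; Boolean clauses as usual. A relation $R$ is Euclidean if $xRy$ and $xRz$ imply $yRz$. -}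

module Defs where

open import Level using (0ℓ)
open import Data.Product using (_×_)
open import Relation.Nullary using (¬_)
open import Relation.Binary.Core using (Rel)
open import Function.Bundles using (_⇔_)

data Form (P : Set) : Set where
  var  : P → Form P
  ¬'_  : Form P → Form P
  _∧'_ : Form P → Form P → Form P
  ⊡_   : Form P → Form P

_⇒'_ : {P : Set} → Form P → Form P → Form P
φ ⇒' ψ = ¬' (φ ∧' (¬' ψ))

record Model (P : Set) : Set₁ where
  field
    S  : Set
    R₁ : Rel S 0ℓ
    R₂ : Rel S 0ℓ
    V  : P → S → Set

open Model public

_,_⊨_ : {P : Set} (M : Model P) → S M → Form P → Set
M , s ⊨ var p   = V M p s
M , s ⊨ (¬' φ)  = ¬ (M , s ⊨ φ)
M , s ⊨ (φ ∧' ψ) = (M , s ⊨ φ) × (M , s ⊨ ψ)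
M , s ⊨ (⊡ φ)   = ∀ t u → R₁ M s t → R₂ M s u → ((M , t ⊨ φ) ⇔ (M , u ⊨ φ))

Euclidean : {A : Set} → Rel A 0ℓ → Set
Euclidean R = ∀ {x y z} → R x y → R x z → R y z

module Submission where

-- The countermodel has states a, b, c, d with  a R₁ b, b R₁ b, c R₁ c,
-- a R₂ c, and R₂ total on {c, d};  the variable p holds at b and d only.
-- Then b ⊨ ⊡p (b has no R₂-successor), c ⊭ ⊡p (c R₁ c, c R₂ d disagree),
-- a ⊭ ⊡p (b and c disagree on p) and a ⊭ ⊡¬⊡p (b and c disagree on ¬⊡p).

open import Defs
open import Data.Product using (Σ; _×_; _,_)
open import Data.Unit using (⊤; tt)
open import Data.Empty using (⊥; ⊥-elim)
open import Relation.Nullary using (¬_)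
open import Function.Bundles using (Equivalence)

module _ {P : Set} (M : Model P) where

  refute-⊡ˡ : ∀ {s t u} (φ : Form P) → R₁ M s t → R₂ M s u →
              M , t ⊨ φ → ¬ (M , u ⊨ φ) → ¬ (M , s ⊨ (⊡ φ))
  refute-⊡ˡ φ st su t⊨φ u⊭φ s⊨⊡φ = u⊭φ (Equivalence.to (s⊨⊡φ _ _ st su) t⊨φ)

  refute-⊡ʳ : ∀ {s t u} (φ : Form P) → R₁ M s t → R₂ M s u →
              ¬ (M , t ⊨ φ) → M , u ⊨ φ → ¬ (M , s ⊨ (⊡ φ))
  refute-⊡ʳ φ st su t⊭φ u⊨φ s⊨⊡φ = t⊭φ (Equivalence.from (s⊨⊡φ _ _ st su) u⊨φ)

  ⊡-without-R₂-successors : ∀ {s} (φ : Form P) →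
                            (∀ u → ¬ R₂ M s u) → M , s ⊨ (⊡ φ)
  ⊡-without-R₂-successors φ noSucc t u st su = ⊥-elim (noSucc u su)

  refute-schema : ∀ {s} (φ : Form P) →
                  ¬ (M , s ⊨ (⊡ φ)) → ¬ (M , s ⊨ (⊡ (¬' (⊡ φ)))) →
                  ¬ (M , s ⊨ ((¬' (⊡ φ)) ⇒' (⊡ (¬' (⊡ φ)))))
  refute-schema φ s⊭⊡φ s⊭⊡¬⊡φ s⊨schema = s⊨schema (s⊭⊡φ , s⊭⊡¬⊡φ)

data State : Set where
  a b c d : State

data Step₁ : State → State → Set where
  a→b : Step₁ a b
  b→b : Step₁ b b
  c→c : Step₁ c c

data Step₂ : State → State → Set where
  a→c : Step₂ a c
  c→c : Step₂ c c
  c→d : Step₂ c d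
  d→c : Step₂ d c
  d→d : Step₂ d d

holds : State → Set
holds b = ⊤
holds d = ⊤
holds _ = ⊥

countermodel : (P : Set) → Model P
countermodel P = record { S = State ; R₁ = Step₁ ; R₂ = Step₂ ; V = λ _ → holds }

step₁-euclidean : Euclidean Step₁
step₁-euclidean a→b a→b = b→b
step₁-euclidean b→b b→b = b→b
step₁-euclidean c→c c→c = c→c

step₂-euclidean : Euclidean Step₂
step₂-euclidean a→c a→c = c→c
step₂-euclidean c→c c→c = c→c
step₂-euclidean c→c c→d = c→d
step₂-euclidean c→d c→c = d→c
step₂-euclidean c→d c→d = d→d
step₂-euclidean d→c d→c = c→c
step₂-euclidean d→c d→d = c→d
step₂-euclidean d→d d→c = d→c
step₂-euclidean d→d d→d = d→d

b-is-R₂-dead-end : ∀ u → ¬ Step₂ b u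
b-is-R₂-dead-end _ ()

proposition7p33 : (P : Set) → P →
    Σ (Model P) λ M → Euclidean (R₁ M) × Euclidean (R₂ M) ×
    Σ (S M) λ s → Σ (Form P) λ φ →
    ¬ (M , s ⊨ ((¬' (⊡ φ)) ⇒' (⊡ (¬' (⊡ φ)))))
proposition7p33 P p =
  M , step₁-euclidean , step₂-euclidean , a , var p ,
  refute-schema M (var p) a⊭⊡p a⊭⊡¬⊡p
  where
  M : Model P
  M = countermodel P

  b⊨⊡p : M , b ⊨ (⊡ var p)
  b⊨⊡p = ⊡-without-R₂-successors M (var p) b-is-R₂-dead-end

  c⊭⊡p : ¬ (M , c ⊨ (⊡ var p))
  c⊭⊡p = refute-⊡ʳ M (var p) c→c c→d (λ ()) tt

  a⊭⊡p : ¬ (M , a ⊨ (⊡ var p))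
  a⊭⊡p = refute-⊡ˡ M (var p) a→b a→c tt (λ ())

  a⊭⊡¬⊡p : ¬ (M , a ⊨ (⊡ (¬' (⊡ var p))))
  a⊭⊡¬⊡p = refute-⊡ʳ M (¬' (⊡ var p)) a→b a→c (λ b⊭⊡p → b⊭⊡p b⊨⊡p) c⊭⊡p
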